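{- Let $p\ge 7$ be prime and let $U$ be a multiset of elements of $\mathbb Z/p\mathbb Z$ of total size $u$, such that $v_\alpha(U)\le h$ for all nonzero $\alpha$ and $v_0(U)=0$, where $h\ge 4$. If $u>\frac{p-2}{2}h$, then $\Sigma_\ell(U)=\mathbb Z/p\mathbb Z$ for every integer $\ell$ with $3\le \ell\le u-p+1$.
   Context: For a multiset $U$ in an abelian group $G$, $v_\alpha(U)$ denotes the multiplicity of $\alpha$ in $U$, and for an integer $\ell\ge 0$, $\Sigma_\ell(U)=\{\sum_{\alpha\in G}c_\alpha\alpha:\ c_\alpha\in\mathbb Z,\ 0\le c_\alpha\le v_\alpha(U),\ \sum_\alpha c_\alpha=\ell\}$. -}

module Defs where

open import Data.Nat using (ℕ; _+_; _*_; _≤_; _%_; NonZero)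
open import Data.Fin using (Fin; toℕ)
open import Data.Fin.Properties using ()
open import Data.Product using (Σ; _×_)
open import Relation.Binary.PropositionalEquality using (_≡_)

∑ : ∀ {n} → (Fin n → ℕ) → ℕ
∑ {ℕ.zero} f = 0
∑ {ℕ.suc n} f = f Fin.zero + ∑ (λ i → f (Fin.suc i))

-- A multiset U in ℤ/pℤ is its multiplicity function v : Fin p → ℕ,
-- where the residue class of k is represented by the element of Fin p with toℕ = k.
Multiset : ℕ → Set
Multiset p = Fin p → ℕ

size : ∀ {p} → Multiset p → ℕ
size v = ∑ v

InSigma : ∀ {p} .{{_ : NonZero p}} → Multiset p → ℕ → Fin p → Set
InSigma {p} v ℓ x =
  Σ (Fin p → ℕ) λ c →
    ((α : Fin p) → c α ≤ v α) ×
    (∑ c ≡ ℓ) ×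
    (∑ (λ α → c α * toℕ α) % p ≡ toℕ x)

SigmaFull : ∀ {p} .{{_ : NonZero p}} → Multiset p → ℕ → Set
SigmaFull {p} v ℓ = (x : Fin p) → InSigma v ℓ x

-- Write Nₘ(v) = ∑ min(v α, m). By induction on m, Σₘ(v) contains a set of size at least
-- min(p, Nₘ(v) − m + 1): if S is the set of α with v α > k (or a point of the support of v
-- when there is none), then Σₖ(v − 1_S) + S ⊆ Σₖ₊₁(v) and Nₖ₊₁(v) ≤ Nₖ(v − 1_S) + ∣S∣, so the
-- Cauchy–Davenport theorem carries the bound from k to k + 1. Since min(v α, ℓ) ≥ v α ℓ / h,
-- the hypothesis u > (p − 2) h / 2 gives 2 N_ℓ(v) > (p − 2) ℓ, which forces N_ℓ(v) ≥ p + ℓ − 1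
-- (the case p = 7, ℓ = 3 needs a separate count); hence Σ_ℓ(v) = ℤ/pℤ.

module Submission where

open import Defs
import Algebra.Properties.CommutativeMonoid.Sum as CommutativeMonoidSum
open import Data.Bool using (Bool; true; false; T; _∧_; _∨_)
open import Data.Bool.Properties using (T-∧; T-∨; T?)
open import Data.Fin using (Fin; zero; suc; toℕ; fromℕ<)
open import Data.Fin.Permutation using (Permutation; permutation)
open import Data.Fin.Properties using (toℕ-fromℕ<; toℕ-injective; toℕ<n; any?)
  renaming (_≟_ to _≟ᶠ_; suc-injective to fsuc-injective)
open import Data.Nat
  using (ℕ; zero; suc; _+_; _*_; _≤_; _<_; _∸_; _⊓_; z≤n; s≤s; z<s; _≤?_; _<?_; _≟_; NonZero; ≢-nonZero; >-nonZero)
open import Data.Nat.Coprimality using (coprime-Bézout; prime⇒coprime)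
open import Data.Nat.DivMod
  using (_%_; m%n<n; m<n⇒m%n≡m; n%n≡0; %-distribˡ-+; [m+n]%n≡m%n; [m+kn]%n≡m%n; m*n%n≡0)
open import Data.Nat.Divisibility using (divides)
open import Data.Nat.GCD using (module Bézout)
open import Data.Nat.Primality using (Prime; prime⇒¬composite; composite-∣; composite[4])
open import Data.Nat.Properties
open import Data.Nat.Solver using (module +-*-Solver)
open import Data.Product using (∃; ∃₂; _×_; _,_; proj₁; proj₂)
open import Data.Sum using (_⊎_; inj₁; inj₂)
open import Function using (_∘_; Equivalence)
open import Relation.Nullary using (¬_; yes; no; contradiction; _×-dec_; ¬?)
open import Relation.Nullary.Decidable using (⌊_⌋; toWitness; fromWitness)
open import Relation.Binary.PropositionalEquality

open +-*-Solver using (solve; _:+_; _:*_; _:=_; con)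

module ℕ-Sum = CommutativeMonoidSum +-0-commutativeMonoid

∑≡sum : ∀ {n} (f : Fin n → ℕ) → ∑ f ≡ ℕ-Sum.sum f
∑≡sum {zero}  f = refl
∑≡sum {suc n} f = cong (f zero +_) (∑≡sum (f ∘ suc))

∑-cong : ∀ {n} {f g : Fin n → ℕ} → f ≗ g → ∑ f ≡ ∑ g
∑-cong {zero}  f≗g = refl
∑-cong {suc n} f≗g = cong₂ _+_ (f≗g zero) (∑-cong (f≗g ∘ suc))

∑-mono-≤ : ∀ {n} {f g : Fin n → ℕ} → (∀ i → f i ≤ g i) → ∑ f ≤ ∑ g
∑-mono-≤ {zero}  f≤g = z≤n
∑-mono-≤ {suc n} f≤g = +-mono-≤ (f≤g zero) (∑-mono-≤ (f≤g ∘ suc))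

∑-distrib-+ : ∀ {n} (f g : Fin n → ℕ) → ∑ (λ i → f i + g i) ≡ ∑ f + ∑ g
∑-distrib-+ f g = begin
  ∑ (λ i → f i + g i)          ≡⟨ ∑≡sum (λ i → f i + g i) ⟩
  ℕ-Sum.sum (λ i → f i + g i)  ≡⟨ ℕ-Sum.∑-distrib-+ f g ⟩
  ℕ-Sum.sum f + ℕ-Sum.sum g    ≡⟨ cong₂ _+_ (∑≡sum f) (∑≡sum g) ⟨
  ∑ f + ∑ g                    ∎
  where open ≡-Reasoning

∑-distribʳ-* : ∀ {n} (f : Fin n → ℕ) c → ∑ (λ i → f i * c) ≡ ∑ f * c
∑-distribʳ-* {zero}  f c = refl
∑-distribʳ-* {suc n} f c =
  trans (cong (f zero * c +_) (∑-distribʳ-* (f ∘ suc) c)) (sym (*-distribʳ-+ c (f zero) _))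

∑-const : ∀ n c → ∑ {n} (λ _ → c) ≡ n * c
∑-const zero    c = refl
∑-const (suc n) c = cong (c +_) (∑-const n c)

∑-single : ∀ {n} (f : Fin n → ℕ) a → (∀ i → i ≢ a → f i ≡ 0) → ∑ f ≡ f a
∑-single {suc n} f zero f≡0 = begin
  f zero + ∑ (f ∘ suc)           ≡⟨ cong (f zero +_) (∑-cong (λ i → f≡0 (suc i) λ ())) ⟩
  f zero + ∑ {n} (λ _ → 0)       ≡⟨ cong (f zero +_) (trans (∑-const n 0) (*-zeroʳ n)) ⟩
  f zero + 0                     ≡⟨ +-identityʳ (f zero) ⟩
  f zero                         ∎
  where open ≡-Reasoning
∑-single {suc n} f (suc a) f≡0 =
  cong₂ _+_ (f≡0 zero λ ()) (∑-single (f ∘ suc) a (λ i i≢a → f≡0 (suc i) (i≢a ∘ fsuc-injective)))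

term≤∑ : ∀ {n} (f : Fin n → ℕ) a → f a ≤ ∑ f
term≤∑ f zero    = m≤m+n _ _
term≤∑ f (suc a) = ≤-trans (term≤∑ (f ∘ suc) a) (m≤n+m _ _)

∑-positive : ∀ {n} (f : Fin n → ℕ) → 0 < ∑ f → ∃ λ i → 0 < f i
∑-positive {suc n} f 0<∑f with f zero in eq
... | suc _ = zero , subst (0 <_) (sym eq) z<s
... | zero with ∑-positive (f ∘ suc) 0<∑f
...   | i , 0<fi = suc i , 0<fi

∑-∸-+ : ∀ {n} (f g : Fin n → ℕ) → (∀ i → g i ≤ f i) → ∑ (λ i → f i ∸ g i) + ∑ g ≡ ∑ f
∑-∸-+ f g g≤f = trans (sym (∑-distrib-+ (λ i → f i ∸ g i) g)) (∑-cong (λ i → m∸n+n≡m (g≤f i)))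

∑-≤-tight : ∀ {n} (f g : Fin n → ℕ) → (∀ i → f i ≤ g i) → ∑ g ≤ ∑ f → ∀ i → g i ≤ f i
∑-≤-tight f g f≤g ∑g≤∑f zero =
  +-cancelʳ-≤ _ _ _ (≤-trans ∑g≤∑f (+-monoʳ-≤ (f zero) (∑-mono-≤ (f≤g ∘ suc))))
∑-≤-tight f g f≤g ∑g≤∑f (suc i) =
  ∑-≤-tight (f ∘ suc) (g ∘ suc) (f≤g ∘ suc)
    (+-cancelˡ-≤ (g zero) _ _ (≤-trans ∑g≤∑f (+-monoˡ-≤ _ (f≤g zero)))) i

FinSet : ℕ → Set
FinSet n = Fin n → Bool

𝟙 : Bool → ℕ
𝟙 true  = 1
𝟙 false = 0

∣_∣ : ∀ {n} → FinSet n → ℕ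
∣ X ∣ = ∑ (𝟙 ∘ X)

infix 4 _⊆_

_⊆_ : ∀ {n} → FinSet n → FinSet n → Set
X ⊆ Y = ∀ x → T (X x) → T (Y x)

⁅_⁆ : ∀ {n} → Fin n → FinSet n
⁅ a ⁆ x = ⌊ x ≟ᶠ a ⌋

∅ : ∀ {n} → FinSet n
∅ _ = false

𝟙-T : ∀ {b} → T b → 𝟙 b ≡ 1
𝟙-T {true} _ = refl

𝟙-¬T : ∀ {b} → ¬ T b → 𝟙 b ≡ 0
𝟙-¬T {true}  ¬b = contradiction _ ¬b
𝟙-¬T {false} _  = refl

𝟙-mono : ∀ {a b} → (T a → T b) → 𝟙 a ≤ 𝟙 b
𝟙-mono {false}         _   = z≤n
𝟙-mono {true} {true}   _   = ≤-refl
𝟙-mono {true} {false} a⇒b = contradiction _ a⇒b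

𝟙-reflect : ∀ {a b} → 𝟙 a ≤ 𝟙 b → T a → T b
𝟙-reflect {true} {true} _ _ = _

∣∅∣≡0 : ∀ n → ∣ ∅ {n} ∣ ≡ 0
∣∅∣≡0 n = trans (∑-const n 0) (*-zeroʳ n)

∈⁅⁆⇒≡ : ∀ {n} {a x : Fin n} → T (⁅ a ⁆ x) → x ≡ a
∈⁅⁆⇒≡ = toWitness

a∈⁅a⁆ : ∀ {n} (a : Fin n) → T (⁅ a ⁆ a)
a∈⁅a⁆ a = fromWitness refl

⁅⁆⊆ : ∀ {n} (X : FinSet n) {a} → T (X a) → ⁅ a ⁆ ⊆ X
⁅⁆⊆ X a∈X x x∈⁅a⁆ = subst (T ∘ X) (sym (∈⁅⁆⇒≡ x∈⁅a⁆)) a∈X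

∑-⁅⁆ : ∀ {n} (a : Fin n) (f : Fin n → ℕ) → ∑ (λ x → 𝟙 (⁅ a ⁆ x) * f x) ≡ f a
∑-⁅⁆ a f = begin
  ∑ (λ x → 𝟙 (⁅ a ⁆ x) * f x)  ≡⟨ ∑-single _ a (λ x x≢a → cong (_* f x) (𝟙-¬T (x≢a ∘ ∈⁅⁆⇒≡))) ⟩
  𝟙 (⁅ a ⁆ a) * f a            ≡⟨ cong (_* f a) (𝟙-T (a∈⁅a⁆ a)) ⟩
  1 * f a                      ≡⟨ *-identityˡ (f a) ⟩
  f a                          ∎
  where open ≡-Reasoning

∣⁅a⁆∣≡1 : ∀ {n} (a : Fin n) → ∣ ⁅ a ⁆ ∣ ≡ 1
∣⁅a⁆∣≡1 a = trans (∑-cong (λ x → sym (*-identityʳ (𝟙 (⁅ a ⁆ x))))) (∑-⁅⁆ a (λ _ → 1))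

⊆⇒∣∣≤ : ∀ {n} (X Y : FinSet n) → X ⊆ Y → ∣ X ∣ ≤ ∣ Y ∣
⊆⇒∣∣≤ X Y X⊆Y = ∑-mono-≤ (λ x → 𝟙-mono (X⊆Y x))

⊆∧∣∣≥⇒⊇ : ∀ {n} (X Y : FinSet n) → X ⊆ Y → ∣ Y ∣ ≤ ∣ X ∣ → Y ⊆ X
⊆∧∣∣≥⇒⊇ X Y X⊆Y ∣Y∣≤∣X∣ x =
  𝟙-reflect (∑-≤-tight (𝟙 ∘ X) (𝟙 ∘ Y) (λ x → 𝟙-mono (X⊆Y x)) ∣Y∣≤∣X∣ x)

∈⇒∣∣≥1 : ∀ {n} (X : FinSet n) {x} → T (X x) → 1 ≤ ∣ X ∣
∈⇒∣∣≥1 X {x} x∈X = subst (_≤ ∣ X ∣) (∣⁅a⁆∣≡1 x) (⊆⇒∣∣≤ ⁅ x ⁆ X (⁅⁆⊆ X x∈X))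

∣∣≥1⇒∈ : ∀ {n} (X : FinSet n) → 1 ≤ ∣ X ∣ → ∃ λ x → T (X x)
∣∣≥1⇒∈ {n} X 1≤∣X∣ with any? (λ x → T? (X x))
... | yes x∈X = x∈X
... | no  ∄x  = contradiction (≤-trans 1≤∣X∣ (≤-trans (⊆⇒∣∣≤ X ∅ X⊆∅) (≤-reflexive (∣∅∣≡0 n)))) λ ()
  where
  X⊆∅ : X ⊆ ∅
  X⊆∅ x x∈X = ∄x (x , x∈X)

∣∣≥2⇒∈≢ : ∀ {n} (X : FinSet n) b → 2 ≤ ∣ X ∣ → ∃ λ b′ → T (X b′) × b′ ≢ b
∣∣≥2⇒∈≢ X b 2≤∣X∣ with any? (λ y → T? (X y) ×-dec ¬? (y ≟ᶠ b))
... | yes (b′ , b′∈X , b′≢b) = b′ , b′∈X , b′≢b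
... | no  ∄b′ =
  contradiction (≤-trans 2≤∣X∣ (subst (∣ X ∣ ≤_) (∣⁅a⁆∣≡1 b) (⊆⇒∣∣≤ X ⁅ b ⁆ X⊆⁅b⁆))) λ { (s≤s ()) }
  where
  X⊆⁅b⁆ : X ⊆ ⁅ b ⁆
  X⊆⁅b⁆ y y∈X with y ≟ᶠ b
  ... | yes _   = _
  ... | no  y≢b = ∄b′ (y , y∈X , y≢b)

∣full∣≡n : ∀ n → ∣ (λ (_ : Fin n) → true) ∣ ≡ n
∣full∣≡n n = trans (∑-const n 1) (*-identityʳ n)

∣∣≥n⇒full : ∀ {n} (X : FinSet n) → n ≤ ∣ X ∣ → ∀ x → T (X x)
∣∣≥n⇒full {n} X n≤∣X∣ x =
  ⊆∧∣∣≥⇒⊇ X (λ _ → true) (λ _ _ → _) (subst (_≤ ∣ X ∣) (sym (∣full∣≡n n)) n≤∣X∣) x _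

full⇒∣∣≥n : ∀ {n} (X : FinSet n) → (∀ x → T (X x)) → n ≤ ∣ X ∣
full⇒∣∣≥n {n} X full = subst (_≤ ∣ X ∣) (∣full∣≡n n) (⊆⇒∣∣≤ (λ _ → true) X (λ x _ → full x))

cappedSize : ∀ {n} → (Fin n → ℕ) → ℕ → ℕ
cappedSize v m = ∑ (λ α → v α ⊓ m)

lower : ∀ {n} → (Fin n → ℕ) → FinSet n → (Fin n → ℕ)
lower v S α = v α ∸ 𝟙 (S α)

cappedSize-zero : ∀ {n} (v : Fin n → ℕ) → cappedSize v 0 ≡ 0
cappedSize-zero {n} v = trans (∑-cong (⊓-zeroʳ ∘ v)) (trans (∑-const n 0) (*-zeroʳ n))

cappedSize-≡-∑ : ∀ {n} (v : Fin n → ℕ) {m} → (∀ α → v α ≤ m) → cappedSize v m ≡ ∑ v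
cappedSize-≡-∑ v v≤m = ∑-cong (λ α → m≤n⇒m⊓n≡m (v≤m α))

⊓-suc≤ : ∀ v k b → 𝟙 b ≤ v → v ≤ k ⊎ T b → v ⊓ suc k ≤ (v ∸ 𝟙 b) ⊓ k + 𝟙 b
⊓-suc≤ (suc v) k true  _  _          = ≤-reflexive (+-comm 1 (v ⊓ k))
⊓-suc≤ v       k false _  (inj₁ v≤k) = ≤-reflexive (begin
  v ⊓ suc k   ≡⟨ m≤n⇒m⊓n≡m (m≤n⇒m≤1+n v≤k) ⟩
  v           ≡⟨ m≤n⇒m⊓n≡m v≤k ⟨
  v ⊓ k       ≡⟨ +-identityʳ (v ⊓ k) ⟨
  v ⊓ k + 0   ∎)
  where open ≡-Reasoning

cappedSize-suc≤ : ∀ {n} (v : Fin n → ℕ) (S : FinSet n) k →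
                  (∀ α → 𝟙 (S α) ≤ v α) → (∀ α → v α ≤ k ⊎ T (S α)) →
                  cappedSize v (suc k) ≤ cappedSize (lower v S) k + ∣ S ∣
cappedSize-suc≤ v S k S≤v small =
  ≤-trans (∑-mono-≤ (λ α → ⊓-suc≤ (v α) k (S α) (S≤v α) (small α)))
          (≤-reflexive (∑-distrib-+ (λ α → lower v S α ⊓ k) (𝟙 ∘ S)))

atLeast : ∀ {n} → (Fin n → ℕ) → ℕ → FinSet n
atLeast v m α = ⌊ m ≤? v α ⌋

𝟙-atLeast≤ : ∀ {n} (v : Fin n → ℕ) k α → 𝟙 (atLeast v (suc k) α) ≤ v α
𝟙-atLeast≤ v k α with suc k ≤? v α
... | yes k<vα = ≤-trans (s≤s z≤n) k<vα
... | no  _    = z≤n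

≤∨atLeast : ∀ {n} (v : Fin n → ℕ) k α → v α ≤ k ⊎ T (atLeast v (suc k) α)
≤∨atLeast v k α with suc k ≤? v α
... | yes _    = inj₂ _
... | no  k≮vα = inj₁ (≤-pred (≰⇒> k≮vα))

𝟙-⁅⁆≤ : ∀ {n} (v : Fin n → ℕ) {a} → 0 < v a → ∀ α → 𝟙 (⁅ a ⁆ α) ≤ v α
𝟙-⁅⁆≤ v {a} 0<va α with α ≟ᶠ a
... | yes refl = 0<va
... | no  _    = z≤n

∑-lower-⁅⁆ : ∀ {n} (v : Fin n → ℕ) {a} → 0 < v a → ∑ (lower v ⁅ a ⁆) + 1 ≡ ∑ v
∑-lower-⁅⁆ v {a} 0<va =
  trans (cong (∑ (lower v ⁅ a ⁆) +_) (sym (∣⁅a⁆∣≡1 a))) (∑-∸-+ v (𝟙 ∘ ⁅ a ⁆) (𝟙-⁅⁆≤ v 0<va))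

+-swapʳ : ∀ x y z → x + y + z ≡ x + z + y
+-swapʳ = solve 3 (λ x y z → x :+ y :+ z := x :+ z :+ y) refl

-- The additive group ℤ/Pℤ with P = q + 1

module ZMod (q : ℕ) where

  P : ℕ
  P = suc q

  Z : Set
  Z = Fin P

  ⟦_⟧ : ℕ → Z
  ⟦ n ⟧ = fromℕ< (m%n<n n P)

  toℕ-⟦⟧ : ∀ n → toℕ ⟦ n ⟧ ≡ n % P
  toℕ-⟦⟧ n = toℕ-fromℕ< (m%n<n n P)

  ⟦⟧-cong : ∀ {m n} → m % P ≡ n % P → ⟦ m ⟧ ≡ ⟦ n ⟧
  ⟦⟧-cong {m} {n} eq = toℕ-injective (trans (toℕ-⟦⟧ m) (trans eq (sym (toℕ-⟦⟧ n))))

  ⟦toℕ⟧ : ∀ a → ⟦ toℕ a ⟧ ≡ a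
  ⟦toℕ⟧ a = toℕ-injective (trans (toℕ-⟦⟧ (toℕ a)) (m<n⇒m%n≡m (toℕ<n a)))

  %≡toℕ⇒⟦⟧≡ : ∀ {n a} → n % P ≡ toℕ a → ⟦ n ⟧ ≡ a
  %≡toℕ⇒⟦⟧≡ {n} eq = toℕ-injective (trans (toℕ-⟦⟧ n) eq)

  ⟦⟧≡⇒%≡toℕ : ∀ {n a} → ⟦ n ⟧ ≡ a → n % P ≡ toℕ a
  ⟦⟧≡⇒%≡toℕ {n} eq = trans (sym (toℕ-⟦⟧ n)) (cong toℕ eq)

  infix  8 -_
  infixl 6 _⊕_ _⊖_

  _⊕_ : Z → Z → Z
  a ⊕ b = ⟦ toℕ a + toℕ b ⟧

  -_ : Z → Z
  - a = ⟦ P ∸ toℕ a ⟧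

  _⊖_ : Z → Z → Z
  a ⊖ b = a ⊕ - b

  ⟦⟧-⊕ : ∀ m n → ⟦ m ⟧ ⊕ ⟦ n ⟧ ≡ ⟦ m + n ⟧
  ⟦⟧-⊕ m n = ⟦⟧-cong {toℕ ⟦ m ⟧ + toℕ ⟦ n ⟧} {m + n} (begin
    (toℕ ⟦ m ⟧ + toℕ ⟦ n ⟧) % P  ≡⟨ cong₂ (λ x y → (x + y) % P) (toℕ-⟦⟧ m) (toℕ-⟦⟧ n) ⟩
    (m % P + n % P) % P          ≡⟨ %-distribˡ-+ m n P ⟨
    (m + n) % P                  ∎)
    where open ≡-Reasoning

  ⊕-comm : ∀ a b → a ⊕ b ≡ b ⊕ a
  ⊕-comm a b = cong ⟦_⟧ (+-comm (toℕ a) (toℕ b))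

  ⊕-assoc : ∀ a b c → a ⊕ b ⊕ c ≡ a ⊕ (b ⊕ c)
  ⊕-assoc a b c = begin
    ⟦ toℕ a + toℕ b ⟧ ⊕ c            ≡⟨ cong (⟦ toℕ a + toℕ b ⟧ ⊕_) (⟦toℕ⟧ c) ⟨
    ⟦ toℕ a + toℕ b ⟧ ⊕ ⟦ toℕ c ⟧     ≡⟨ ⟦⟧-⊕ (toℕ a + toℕ b) (toℕ c) ⟩
    ⟦ toℕ a + toℕ b + toℕ c ⟧        ≡⟨ cong ⟦_⟧ (+-assoc (toℕ a) (toℕ b) (toℕ c)) ⟩
    ⟦ toℕ a + (toℕ b + toℕ c) ⟧      ≡⟨ ⟦⟧-⊕ (toℕ a) (toℕ b + toℕ c) ⟨
    ⟦ toℕ a ⟧ ⊕ (b ⊕ c)              ≡⟨ cong (_⊕ (b ⊕ c)) (⟦toℕ⟧ a) ⟩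
    a ⊕ (b ⊕ c)                      ∎
    where open ≡-Reasoning

  ⊕-identityʳ : ∀ a → a ⊕ zero ≡ a
  ⊕-identityʳ a = trans (cong ⟦_⟧ (+-identityʳ (toℕ a))) (⟦toℕ⟧ a)

  ⊕-identityˡ : ∀ a → zero ⊕ a ≡ a
  ⊕-identityˡ a = trans (⊕-comm zero a) (⊕-identityʳ a)

  ⊕-inverseˡ : ∀ a → - a ⊕ a ≡ zero
  ⊕-inverseˡ a = begin
    - a ⊕ a                    ≡⟨ cong (- a ⊕_) (⟦toℕ⟧ a) ⟨
    - a ⊕ ⟦ toℕ a ⟧            ≡⟨ ⟦⟧-⊕ (P ∸ toℕ a) (toℕ a) ⟩
    ⟦ P ∸ toℕ a + toℕ a ⟧      ≡⟨ cong ⟦_⟧ (m∸n+n≡m (<⇒≤ (toℕ<n a))) ⟩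
    ⟦ P ⟧                      ≡⟨ ⟦⟧-cong {P} {0} (n%n≡0 P) ⟩
    zero                       ∎
    where open ≡-Reasoning

  ⊖-⊕-cancel : ∀ x e → x ⊖ e ⊕ e ≡ x
  ⊖-⊕-cancel x e = trans (⊕-assoc x (- e) e) (trans (cong (x ⊕_) (⊕-inverseˡ e)) (⊕-identityʳ x))

  ⊕-⊖-cancel : ∀ x e → x ⊕ e ⊖ e ≡ x
  ⊕-⊖-cancel x e =
    trans (⊕-assoc x e (- e))
          (trans (cong (x ⊕_) (trans (⊕-comm e (- e)) (⊕-inverseˡ e))) (⊕-identityʳ x))

  ⊖-⊕-comm : ∀ x y z → x ⊖ y ⊕ z ≡ x ⊕ (z ⊖ y)
  ⊖-⊕-comm x y z = trans (⊕-assoc x (- y) z) (cong (x ⊕_) (⊕-comm (- y) z))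

  ⊖≡zero⇒≡ : ∀ {x y} → x ⊖ y ≡ zero → x ≡ y
  ⊖≡zero⇒≡ {x} {y} eq = trans (sym (⊖-⊕-cancel x y)) (trans (cong (_⊕ y) eq) (⊕-identityˡ y))

  ⊕≡zero⇒⊖≡⊕ : ∀ {u w} a → u ⊕ w ≡ zero → a ⊖ w ≡ a ⊕ u
  ⊕≡zero⇒⊖≡⊕ {u} {w} a eq = begin
    a ⊖ w                ≡⟨ cong (λ t → t ⊖ w) (⊕-identityʳ a) ⟨
    a ⊕ zero ⊖ w         ≡⟨ cong (λ t → a ⊕ t ⊖ w) eq ⟨
    a ⊕ (u ⊕ w) ⊖ w      ≡⟨ cong (_⊖ w) (⊕-assoc a u w) ⟨
    a ⊕ u ⊕ w ⊖ w        ≡⟨ ⊕-⊖-cancel (a ⊕ u) w ⟩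
    a ⊕ u                ∎
    where open ≡-Reasoning

  ∑-shift : ∀ (f : Z → ℕ) e → ∑ (λ x → f (x ⊕ e)) ≡ ∑ f
  ∑-shift f e = begin
    ∑ (f ∘ (_⊕ e))            ≡⟨ ∑≡sum (f ∘ (_⊕ e)) ⟩
    ℕ-Sum.sum (f ∘ (_⊕ e))    ≡⟨ ℕ-Sum.sum-permute f shift ⟨
    ℕ-Sum.sum f               ≡⟨ ∑≡sum f ⟨
    ∑ f                       ∎
    where
    open ≡-Reasoning
    shift : Permutation P P
    shift = permutation (_⊕ e) (_⊖ e) (λ y → ⊖-⊕-cancel y e) (λ x → ⊕-⊖-cancel x e)

  ∣∣-shift : ∀ (X : FinSet P) e → ∣ X ∘ (_⊕ e) ∣ ≡ ∣ X ∣
  ∣∣-shift X e = ∑-shift (𝟙 ∘ X) e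

  -- Sumsets and the Cauchy–Davenport theorem

  infixl 6 _⊞_

  _⊞_ : FinSet P → FinSet P → FinSet P
  (A ⊞ B) z = ⌊ any? (λ b → T? (A (z ⊖ b) ∧ B b)) ⌋

  ⊞-intro : ∀ (A B : FinSet P) {a b} → T (A a) → T (B b) → T ((A ⊞ B) (a ⊕ b))
  ⊞-intro A B {a} {b} a∈A b∈B =
    fromWitness (b , Equivalence.from T-∧ (subst (T ∘ A) (sym (⊕-⊖-cancel a b)) a∈A , b∈B))

  ⊞-elim : ∀ (A B : FinSet P) {z} → T ((A ⊞ B) z) → ∃₂ λ a b → T (A a) × T (B b) × a ⊕ b ≡ z
  ⊞-elim A B {z} z∈A⊞B with toWitness z∈A⊞B
  ... | b , z⊖b∈A∧b∈B with Equivalence.to T-∧ z⊖b∈A∧b∈B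
  ...   | z⊖b∈A , b∈B = z ⊖ b , b , z⊖b∈A , b∈B , ⊖-⊕-cancel z b

  ∣∣≤∣⊞∣ : ∀ (A B : FinSet P) {b} → T (B b) → ∣ A ∣ ≤ ∣ A ⊞ B ∣
  ∣∣≤∣⊞∣ A B {b} b∈B = subst (_≤ ∣ A ⊞ B ∣) (∣∣-shift A (- b)) (⊆⇒∣∣≤ (A ∘ (_⊖ b)) (A ⊞ B) A-b⊆A⊞B)
    where
    A-b⊆A⊞B : A ∘ (_⊖ b) ⊆ A ⊞ B
    A-b⊆A⊞B z z⊖b∈A = subst (T ∘ (A ⊞ B)) (⊖-⊕-cancel z b) (⊞-intro A B z⊖b∈A b∈B)

  ⊕-Closed : FinSet P → Z → Set
  ⊕-Closed A d = ∀ a → T (A a) → T (A (a ⊕ d))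

  -- A set closed under x ↦ x + e is mapped into itself injectively, hence onto itself.
  ⊕-Closed⇒⊖-Closed : ∀ A {e} → ⊕-Closed A e → ⊕-Closed A (- e)
  ⊕-Closed⇒⊖-Closed A {e} cl a a∈A =
    ⊆∧∣∣≥⇒⊇ A (A ∘ (_⊕ e)) cl (≤-reflexive (∣∣-shift A e)) (a ⊖ e)
      (subst (T ∘ A) (sym (⊖-⊕-cancel a e)) a∈A)

  ⊕-Closed-* : ∀ A {n} → ⊕-Closed A ⟦ n ⟧ → ∀ j → ⊕-Closed A ⟦ j * n ⟧
  ⊕-Closed-* A     cl zero    a a∈A = subst (T ∘ A) (sym (⊕-identityʳ a)) a∈A
  ⊕-Closed-* A {n} cl (suc j) a a∈A =
    subst (T ∘ A) a+n+jn≡a+[n+jn] (⊕-Closed-* A cl j (a ⊕ ⟦ n ⟧) (cl a a∈A))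
    where
    a+n+jn≡a+[n+jn] : a ⊕ ⟦ n ⟧ ⊕ ⟦ j * n ⟧ ≡ a ⊕ ⟦ n + j * n ⟧
    a+n+jn≡a+[n+jn] = trans (⊕-assoc a ⟦ n ⟧ ⟦ j * n ⟧) (cong (a ⊕_) (⟦⟧-⊕ n (j * n)))

  -- Bézout gives y with y·d ≡ ±1 (mod P); the sign −1 is handled by ⊕-Closed⇒⊖-Closed.
  ⊕-Closed-⟦1⟧ : Prime P → ∀ A {d} → d ≢ zero → ⊕-Closed A d → ⊕-Closed A ⟦ 1 ⟧
  ⊕-Closed-⟦1⟧ isPrime A {d} d≢0 cl
    with coprime-Bézout (prime⇒coprime isPrime {{≢-nonZero (d≢0 ∘ toℕ-injective)}} (toℕ<n d))
  ... | Bézout.-+ x y 1+xP≡yd = subst (⊕-Closed A) ⟦yd⟧≡⟦1⟧ (⊕-Closed-* A cl′ y)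
    where
    ⟦yd⟧≡⟦1⟧ : ⟦ y * toℕ d ⟧ ≡ ⟦ 1 ⟧
    ⟦yd⟧≡⟦1⟧ = ⟦⟧-cong {y * toℕ d} {1} (trans (cong (_% P) (sym 1+xP≡yd)) ([m+kn]%n≡m%n 1 x P))
    cl′ : ⊕-Closed A ⟦ toℕ d ⟧
    cl′ = subst (⊕-Closed A) (sym (⟦toℕ⟧ d)) cl
  ... | Bézout.+- x y 1+yd≡xP = λ a a∈A →
    subst (T ∘ A) (⊕≡zero⇒⊖≡⊕ a ⟦1⟧+⟦yd⟧≡0) (⊕-Closed⇒⊖-Closed A (⊕-Closed-* A cl′ y) a a∈A)
    where
    ⟦1⟧+⟦yd⟧≡0 : ⟦ 1 ⟧ ⊕ ⟦ y * toℕ d ⟧ ≡ zero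
    ⟦1⟧+⟦yd⟧≡0 = trans (⟦⟧-⊕ 1 (y * toℕ d))
                       (⟦⟧-cong {1 + y * toℕ d} {0} (trans (cong (_% P) 1+yd≡xP) (m*n%n≡0 x P)))
    cl′ : ⊕-Closed A ⟦ toℕ d ⟧
    cl′ = subst (⊕-Closed A) (sym (⟦toℕ⟧ d)) cl

  ⊕-Closed⇒full : Prime P → ∀ A {d a} → d ≢ zero → ⊕-Closed A d → T (A a) → ∀ x → T (A x)
  ⊕-Closed⇒full isPrime A {d} {a} d≢0 cl a∈A x =
    subst (T ∘ A) a+m≡x (⊕-Closed-* A (⊕-Closed-⟦1⟧ isPrime A d≢0 cl) m a a∈A)
    where
    m : ℕ
    m = toℕ x + (P ∸ toℕ a)
    a+m≡x : a ⊕ ⟦ m * 1 ⟧ ≡ x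
    a+m≡x = begin
      a ⊕ ⟦ m * 1 ⟧              ≡⟨ cong₂ _⊕_ (⟦toℕ⟧ a) (cong ⟦_⟧ (sym (*-identityʳ m))) ⟨
      ⟦ toℕ a ⟧ ⊕ ⟦ m ⟧          ≡⟨ ⟦⟧-⊕ (toℕ a) m ⟩
      ⟦ toℕ a + m ⟧              ≡⟨ cong ⟦_⟧ (trans (+-comm (toℕ a) m) (+-assoc (toℕ x) _ (toℕ a))) ⟩
      ⟦ toℕ x + (P ∸ toℕ a + toℕ a) ⟧ ≡⟨ cong (λ t → ⟦ toℕ x + t ⟧) (m∸n+n≡m (<⇒≤ (toℕ<n a))) ⟩
      ⟦ toℕ x + P ⟧              ≡⟨ ⟦⟧-cong {toℕ x + P} {toℕ x} ([m+n]%n≡m%n (toℕ x) P) ⟩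
      ⟦ toℕ x ⟧                  ≡⟨ ⟦toℕ⟧ x ⟩
      x                          ∎
      where open ≡-Reasoning

  Aₑ : FinSet P → FinSet P → Z → FinSet P
  Aₑ A B e x = A x ∨ B (x ⊖ e)

  Bₑ : FinSet P → FinSet P → Z → FinSet P
  Bₑ A B e y = B y ∧ A (y ⊕ e)

  𝟙-∨-∧ : ∀ a b → 𝟙 (a ∨ b) + 𝟙 (b ∧ a) ≡ 𝟙 a + 𝟙 b
  𝟙-∨-∧ true  true  = refl
  𝟙-∨-∧ true  false = refl
  𝟙-∨-∧ false true  = refl
  𝟙-∨-∧ false false = refl

  ∣Aₑ∣+∣Bₑ∣ : ∀ A B e → ∣ Aₑ A B e ∣ + ∣ Bₑ A B e ∣ ≡ ∣ A ∣ + ∣ B ∣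
  ∣Aₑ∣+∣Bₑ∣ A B e = begin
    ∣ Aₑ A B e ∣ + ∣ Bₑ A B e ∣                         ≡⟨ cong (∣ Aₑ A B e ∣ +_) ∣Bₑ∣≡∣C∣ ⟩
    ∣ Aₑ A B e ∣ + ∣ C ∣                                ≡⟨ ∑-distrib-+ (𝟙 ∘ Aₑ A B e) (𝟙 ∘ C) ⟨
    ∑ (λ x → 𝟙 (A x ∨ B (x ⊖ e)) + 𝟙 (B (x ⊖ e) ∧ A x)) ≡⟨ ∑-cong (λ x → 𝟙-∨-∧ (A x) (B (x ⊖ e))) ⟩
    ∑ (λ x → 𝟙 (A x) + 𝟙 (B (x ⊖ e)))                   ≡⟨ ∑-distrib-+ (𝟙 ∘ A) (𝟙 ∘ B ∘ (_⊖ e)) ⟩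
    ∣ A ∣ + ∣ B ∘ (_⊖ e) ∣                              ≡⟨ cong (∣ A ∣ +_) (∣∣-shift B (- e)) ⟩
    ∣ A ∣ + ∣ B ∣                                       ∎
    where
    open ≡-Reasoning
    C : FinSet P
    C x = B (x ⊖ e) ∧ A x
    ∣Bₑ∣≡∣C∣ : ∣ Bₑ A B e ∣ ≡ ∣ C ∣
    ∣Bₑ∣≡∣C∣ = trans (∑-cong (λ y → cong (λ t → 𝟙 (B t ∧ A (y ⊕ e))) (sym (⊕-⊖-cancel y e))))
                     (∣∣-shift C e)

  A⊆Aₑ : ∀ A B e → A ⊆ Aₑ A B e
  A⊆Aₑ A B e x x∈A = Equivalence.from T-∨ (inj₁ x∈A)

  Aₑ⊞Bₑ⊆A⊞B : ∀ A B e → Aₑ A B e ⊞ Bₑ A B e ⊆ A ⊞ B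
  Aₑ⊞Bₑ⊆A⊞B A B e z z∈Aₑ⊞Bₑ = sum∈A⊞B (⊞-elim (Aₑ A B e) (Bₑ A B e) z∈Aₑ⊞Bₑ)
    where
    by-cases : ∀ {a b} → T (A a) ⊎ T (B (a ⊖ e)) → T (B b) × T (A (b ⊕ e)) → T ((A ⊞ B) (a ⊕ b))
    by-cases         (inj₁ a∈A)   (b∈B , _)   = ⊞-intro A B a∈A b∈B
    by-cases {a} {b} (inj₂ a⊖e∈B) (_ , b⊕e∈A) = subst (T ∘ (A ⊞ B)) b⊕e⊕a⊖e≡a⊕b (⊞-intro A B b⊕e∈A a⊖e∈B)
      where
      b⊕e⊕a⊖e≡a⊕b : b ⊕ e ⊕ (a ⊖ e) ≡ a ⊕ b
      b⊕e⊕a⊖e≡a⊕b =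
        trans (⊕-comm (b ⊕ e) (a ⊖ e)) (trans (⊖-⊕-comm a e (b ⊕ e)) (cong (a ⊕_) (⊕-⊖-cancel b e)))
    sum∈A⊞B : (∃₂ λ a b → T (Aₑ A B e a) × T (Bₑ A B e b) × a ⊕ b ≡ z) → T ((A ⊞ B) z)
    sum∈A⊞B (a , b , a∈Aₑ , b∈Bₑ , a⊕b≡z) =
      subst (T ∘ (A ⊞ B)) a⊕b≡z (by-cases (Equivalence.to T-∨ a∈Aₑ) (Equivalence.to T-∧ b∈Bₑ))

  CauchyDavenportBound : FinSet P → FinSet P → Set
  CauchyDavenportBound A B = P ≤ ∣ A ⊞ B ∣ ⊎ ∣ A ∣ + ∣ B ∣ ≤ ∣ A ⊞ B ∣ + 1

  e-transform-bound : ∀ A B e → CauchyDavenportBound (Aₑ A B e) (Bₑ A B e) → CauchyDavenportBound A B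
  e-transform-bound A B e (inj₁ P≤∣Aₑ⊞Bₑ∣) =
    inj₁ (≤-trans P≤∣Aₑ⊞Bₑ∣ (⊆⇒∣∣≤ _ (A ⊞ B) (Aₑ⊞Bₑ⊆A⊞B A B e)))
  e-transform-bound A B e (inj₂ ∣Aₑ∣+∣Bₑ∣≤) = inj₂ (subst (_≤ ∣ A ⊞ B ∣ + 1) (∣Aₑ∣+∣Bₑ∣ A B e)
    (≤-trans ∣Aₑ∣+∣Bₑ∣≤ (+-monoˡ-≤ 1 (⊆⇒∣∣≤ _ (A ⊞ B) (Aₑ⊞Bₑ⊆A⊞B A B e)))))

  Stable : FinSet P → FinSet P → Set
  Stable A B = ∀ e → 1 ≤ ∣ Bₑ A B e ∣ → ∣ B ∣ ≤ ∣ Bₑ A B e ∣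

  -- For a ∈ A and e = a − b, b lies in Bₑ, so stability forces B ⊆ Bₑ, i.e. B + e ⊆ A.
  stable⇒⊕-Closed : ∀ A B {b b′} → Stable A B → T (B b) → T (B b′) → ⊕-Closed A (b′ ⊖ b)
  stable⇒⊕-Closed A B {b} {b′} stable b∈B b′∈B a a∈A = subst (T ∘ A) b′⊕e≡a⊕d b′⊕e∈A
    where
    e : Z
    e = a ⊖ b
    b∈Bₑ : T (Bₑ A B e b)
    b∈Bₑ = Equivalence.from T-∧
      (b∈B , subst (T ∘ A) (sym (trans (⊕-comm b e) (⊖-⊕-cancel a b))) a∈A)
    B⊆Bₑ : B ⊆ Bₑ A B e
    B⊆Bₑ = ⊆∧∣∣≥⇒⊇ (Bₑ A B e) B (λ y y∈Bₑ → proj₁ (Equivalence.to T-∧ y∈Bₑ))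
                   (stable e (∈⇒∣∣≥1 (Bₑ A B e) b∈Bₑ))
    b′⊕e∈A : T (A (b′ ⊕ e))
    b′⊕e∈A = proj₂ (Equivalence.to T-∧ (B⊆Bₑ b′ b′∈B))
    b′⊕e≡a⊕d : b′ ⊕ e ≡ a ⊕ (b′ ⊖ b)
    b′⊕e≡a⊕d = trans (⊕-comm b′ e) (⊖-⊕-comm a b b′)

  stable⇒bound : Prime P → ∀ A B → Stable A B → 1 ≤ ∣ A ∣ → 1 ≤ ∣ B ∣ → CauchyDavenportBound A B
  stable⇒bound isPrime A B stable 1≤∣A∣ 1≤∣B∣ with ∣∣≥1⇒∈ B 1≤∣B∣
  ... | b , b∈B with 2 ≤? ∣ B ∣
  ...   | no  ∣B∣≱2 = inj₂ (+-mono-≤ (∣∣≤∣⊞∣ A B b∈B) (≤-pred (≰⇒> ∣B∣≱2)))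
  ...   | yes 2≤∣B∣ with ∣∣≥2⇒∈≢ B b 2≤∣B∣ | ∣∣≥1⇒∈ A 1≤∣A∣
  ...     | b′ , b′∈B , b′≢b | a , a∈A = inj₁ (≤-trans (full⇒∣∣≥n A A-full) (∣∣≤∣⊞∣ A B b∈B))
    where
    A-full : ∀ x → T (A x)
    A-full = ⊕-Closed⇒full isPrime A (b′≢b ∘ ⊖≡zero⇒≡) (stable⇒⊕-Closed A B stable b∈B b′∈B) a∈A

  -- Davenport's proof: induction on ∣ B ∣ through e-transforms that shrink B.
  cauchy-davenport : Prime P → ∀ A B → 1 ≤ ∣ A ∣ → 1 ≤ ∣ B ∣ → CauchyDavenportBound A B
  cauchy-davenport isPrime A B = go ∣ B ∣ A B ≤-refl
    where
    go : ∀ n X Y → ∣ Y ∣ ≤ n → 1 ≤ ∣ X ∣ → 1 ≤ ∣ Y ∣ → CauchyDavenportBound X Y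
    go zero    X Y ∣Y∣≤0 _ 1≤∣Y∣ = contradiction (≤-trans 1≤∣Y∣ ∣Y∣≤0) λ ()
    go (suc n) X Y ∣Y∣≤1+n 1≤∣X∣ 1≤∣Y∣
      with any? (λ e → (1 ≤? ∣ Bₑ X Y e ∣) ×-dec (∣ Bₑ X Y e ∣ <? ∣ Y ∣))
    ... | yes (e , 1≤∣Yₑ∣ , ∣Yₑ∣<∣Y∣) = e-transform-bound X Y e
            (go n (Aₑ X Y e) (Bₑ X Y e) (≤-pred (≤-trans ∣Yₑ∣<∣Y∣ ∣Y∣≤1+n))
                (≤-trans 1≤∣X∣ (⊆⇒∣∣≤ X (Aₑ X Y e) (A⊆Aₑ X Y e))) 1≤∣Yₑ∣)
    ... | no ∄e = stable⇒bound isPrime X Y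
            (λ e 1≤∣Yₑ∣ → ≮⇒≥ (λ ∣Yₑ∣<∣Y∣ → ∄e (e , 1≤∣Yₑ∣ , ∣Yₑ∣<∣Y∣))) 1≤∣X∣ 1≤∣Y∣

  -- Large subsets of Σₘ(v)

  InSigma-zero : ∀ (v : Multiset P) → InSigma v 0 zero
  InSigma-zero v = (λ _ → 0) , (λ _ → z≤n) , ∑0≡0 , cong (_% P) ∑0≡0
    where
    ∑0≡0 : ∑ {P} (λ _ → 0) ≡ 0
    ∑0≡0 = trans (∑-const P 0) (*-zeroʳ P)

  InSigma-extend : ∀ (v : Multiset P) (S : FinSet P) {k y b} → (∀ α → 𝟙 (S α) ≤ v α) → T (S b) →
                   InSigma (lower v S) k y → InSigma v (suc k) (y ⊕ b)
  InSigma-extend v S {k} {y} {b} S≤v b∈S (c , c≤ , ∑c≡k , ∑cα≡y) = c′ , c′≤v , ∑c′≡1+k , ∑c′α≡y⊕b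
    where
    c′ : Multiset P
    c′ α = c α + 𝟙 (⁅ b ⁆ α)
    c′≤v : ∀ α → c′ α ≤ v α
    c′≤v α = ≤-trans (+-mono-≤ (c≤ α) (𝟙-mono (⁅⁆⊆ S b∈S α))) (≤-reflexive (m∸n+n≡m (S≤v α)))
    ∑c′≡1+k : ∑ c′ ≡ suc k
    ∑c′≡1+k = trans (∑-distrib-+ c (𝟙 ∘ ⁅ b ⁆)) (trans (cong₂ _+_ ∑c≡k (∣⁅a⁆∣≡1 b)) (+-comm k 1))
    Σcα : ℕ
    Σcα = ∑ (λ α → c α * toℕ α)
    ∑c′α≡y⊕b : ∑ (λ α → c′ α * toℕ α) % P ≡ toℕ (y ⊕ b)
    ∑c′α≡y⊕b = ⟦⟧≡⇒%≡toℕ {∑ (λ α → c′ α * toℕ α)} (begin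
      ⟦ ∑ (λ α → c′ α * toℕ α) ⟧
        ≡⟨ cong ⟦_⟧ (∑-cong (λ α → *-distribʳ-+ (toℕ α) (c α) (𝟙 (⁅ b ⁆ α)))) ⟩
      ⟦ ∑ (λ α → c α * toℕ α + 𝟙 (⁅ b ⁆ α) * toℕ α) ⟧
        ≡⟨ cong ⟦_⟧ (∑-distrib-+ (λ α → c α * toℕ α) (λ α → 𝟙 (⁅ b ⁆ α) * toℕ α)) ⟩
      ⟦ Σcα + ∑ (λ α → 𝟙 (⁅ b ⁆ α) * toℕ α) ⟧
        ≡⟨ cong (λ t → ⟦ Σcα + t ⟧) (∑-⁅⁆ b toℕ) ⟩
      ⟦ Σcα + toℕ b ⟧               ≡⟨ ⟦⟧-⊕ Σcα (toℕ b) ⟨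
      ⟦ Σcα ⟧ ⊕ ⟦ toℕ b ⟧           ≡⟨ cong₂ _⊕_ (%≡toℕ⇒⟦⟧≡ {Σcα} ∑cα≡y) (⟦toℕ⟧ b) ⟩
      y ⊕ b                         ∎)
      where open ≡-Reasoning

  record LargeSubsetOfΣ (m : ℕ) (v : Multiset P) : Set where
    field
      X       : FinSet P
      X⊆Σ     : ∀ x → T (X x) → InSigma v m x
      X≢∅     : 1 ≤ ∣ X ∣
      X-large : P ≤ ∣ X ∣ ⊎ cappedSize v m + 1 ≤ ∣ X ∣ + m

  LargeSubsetOfΣ-zero : ∀ (v : Multiset P) → LargeSubsetOfΣ 0 v
  LargeSubsetOfΣ-zero v = record
    { X       = X₀
    ; X⊆Σ     = λ x x≡0 → subst (InSigma v 0) (sym (∈⁅⁆⇒≡ x≡0)) (InSigma-zero v)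
    ; X≢∅     = ≤-reflexive (sym (∣⁅a⁆∣≡1 {P} zero))
    ; X-large = inj₂ (≤-reflexive (begin
        cappedSize v 0 + 1   ≡⟨ cong (_+ 1) (cappedSize-zero v) ⟩
        1                    ≡⟨ ∣⁅a⁆∣≡1 {P} zero ⟨
        ∣ X₀ ∣               ≡⟨ +-identityʳ ∣ X₀ ∣ ⟨
        ∣ X₀ ∣ + 0           ∎))
    }
    where
    open ≡-Reasoning
    X₀ : FinSet P
    X₀ = ⁅ zero ⁆

  module _ (isPrime : Prime P) where

    LargeSubsetOfΣ-suc : ∀ {k v} (S : FinSet P) {a} → T (S a) → (∀ α → 𝟙 (S α) ≤ v α) →
                         (∀ α → v α ≤ k ⊎ T (S α)) →
                         LargeSubsetOfΣ k (lower v S) → LargeSubsetOfΣ (suc k) v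
    LargeSubsetOfΣ-suc {k} {v} S a∈S S≤v small L = record
      { X = X ⊞ S ; X⊆Σ = X⊞S⊆Σ ; X≢∅ = ≤-trans X≢∅ ∣X∣≤∣X⊞S∣ ; X-large = large X-large }
      where
      open LargeSubsetOfΣ L
      ∣X∣≤∣X⊞S∣ : ∣ X ∣ ≤ ∣ X ⊞ S ∣
      ∣X∣≤∣X⊞S∣ = ∣∣≤∣⊞∣ X S a∈S
      X⊞S⊆Σ : ∀ z → T ((X ⊞ S) z) → InSigma v (suc k) z
      X⊞S⊆Σ z z∈X⊞S = sum∈Σ (⊞-elim X S z∈X⊞S)
        where
        sum∈Σ : (∃₂ λ y b → T (X y) × T (S b) × y ⊕ b ≡ z) → InSigma v (suc k) z
        sum∈Σ (y , b , y∈X , b∈S , y⊕b≡z) =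
          subst (InSigma v (suc k)) y⊕b≡z (InSigma-extend v S S≤v b∈S (X⊆Σ y y∈X))
      large : P ≤ ∣ X ∣ ⊎ cappedSize (lower v S) k + 1 ≤ ∣ X ∣ + k →
              P ≤ ∣ X ⊞ S ∣ ⊎ cappedSize v (suc k) + 1 ≤ ∣ X ⊞ S ∣ + suc k
      large (inj₁ P≤∣X∣) = inj₁ (≤-trans P≤∣X∣ ∣X∣≤∣X⊞S∣)
      large (inj₂ N′+1≤∣X∣+k) with cauchy-davenport isPrime X S X≢∅ (∈⇒∣∣≥1 S a∈S)
      ... | inj₁ P≤∣X⊞S∣ = inj₁ P≤∣X⊞S∣
      ... | inj₂ ∣X∣+∣S∣≤ = inj₂ (begin
        cappedSize v (suc k) + 1                  ≤⟨ +-monoˡ-≤ 1 (cappedSize-suc≤ v S k S≤v small) ⟩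
        cappedSize (lower v S) k + ∣ S ∣ + 1      ≡⟨ +-swapʳ (cappedSize (lower v S) k) (∣ S ∣) 1 ⟩
        cappedSize (lower v S) k + 1 + ∣ S ∣      ≤⟨ +-monoˡ-≤ (∣ S ∣) N′+1≤∣X∣+k ⟩
        ∣ X ∣ + k + ∣ S ∣                         ≡⟨ +-swapʳ (∣ X ∣) k (∣ S ∣) ⟩
        ∣ X ∣ + ∣ S ∣ + k                         ≤⟨ +-monoˡ-≤ k ∣X∣+∣S∣≤ ⟩
        ∣ X ⊞ S ∣ + 1 + k                         ≡⟨ +-assoc (∣ X ⊞ S ∣) 1 k ⟩
        ∣ X ⊞ S ∣ + suc k                         ∎)
        where open ≤-Reasoning

    largeSubsetOfΣ : ∀ m (v : Multiset P) → m ≤ ∑ v → LargeSubsetOfΣ m v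
    largeSubsetOfΣ zero    v _ = LargeSubsetOfΣ-zero v
    largeSubsetOfΣ (suc k) v k<∑v with any? (λ α → suc k ≤? v α)
    ... | yes (a , k<va) = LargeSubsetOfΣ-suc S a∈S (𝟙-atLeast≤ v k) (≤∨atLeast v k)
                             (largeSubsetOfΣ k (lower v S) k≤∑lower)
      where
      S : FinSet P
      S = atLeast v (suc k)
      a∈S : T (S a)
      a∈S = fromWitness k<va
      k≤∑lower : k ≤ ∑ (lower v S)
      k≤∑lower = ≤-trans (subst (λ t → k ≤ v a ∸ t) (sym (𝟙-T a∈S)) (∸-monoˡ-≤ 1 k<va))
                         (term≤∑ (lower v S) a)
    ... | no ∄a with ∑-positive v (≤-trans (s≤s z≤n) k<∑v)
    ...   | a , 0<va = LargeSubsetOfΣ-suc ⁅ a ⁆ (a∈⁅a⁆ a) (𝟙-⁅⁆≤ v 0<va) (λ α → inj₁ (v≤k α))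
                         (largeSubsetOfΣ k (lower v ⁅ a ⁆) k≤∑lower)
      where
      v≤k : ∀ α → v α ≤ k
      v≤k α = ≤-pred (≰⇒> (λ k<vα → ∄a (α , k<vα)))
      k≤∑lower : k ≤ ∑ (lower v ⁅ a ⁆)
      k≤∑lower = ≤-pred (subst (suc k ≤_) (sym (trans (+-comm 1 _) (∑-lower-⁅⁆ v 0<va))) k<∑v)

-- The numerical estimate

m*n≤[m⊓n]*o : ∀ {m n o} → m ≤ o → n ≤ o → m * n ≤ (m ⊓ n) * o
m*n≤[m⊓n]*o {m} {n} {o} m≤o n≤o with ≤-total m n
... | inj₁ m≤n = subst (λ t → m * n ≤ t * o) (sym (m≤n⇒m⊓n≡m m≤n)) (*-monoʳ-≤ m n≤o)
... | inj₂ n≤m = subst (λ t → m * n ≤ t * o) (sym (m≥n⇒m⊓n≡n n≤m))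
                       (≤-trans (*-monoˡ-≤ n m≤o) (≤-reflexive (*-comm o n)))

cappedSize-density : ∀ {n} (v : Fin n → ℕ) {m h ℓ} .{{_ : NonZero ℓ}} → (∀ α → v α ≤ h) → ℓ ≤ h →
                     m * h < 2 * ∑ v → m * ℓ < 2 * cappedSize v ℓ
cappedSize-density v {m} {h} {ℓ} v≤h ℓ≤h mh<2u = *-cancelʳ-< h (m * ℓ) (2 * cappedSize v ℓ) (begin-strict
  m * ℓ * h                 ≡⟨ solve 3 (λ m ℓ h → m :* ℓ :* h := m :* h :* ℓ) refl m ℓ h ⟩
  m * h * ℓ                 <⟨ *-monoˡ-< ℓ mh<2u ⟩
  2 * ∑ v * ℓ               ≡⟨ *-assoc 2 (∑ v) ℓ ⟩
  2 * (∑ v * ℓ)             ≤⟨ *-monoʳ-≤ 2 u*ℓ≤N*h ⟩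
  2 * (cappedSize v ℓ * h)  ≡⟨ *-assoc 2 (cappedSize v ℓ) h ⟨
  2 * cappedSize v ℓ * h    ∎)
  where
  open ≤-Reasoning
  u*ℓ≤N*h : ∑ v * ℓ ≤ cappedSize v ℓ * h
  u*ℓ≤N*h = subst₂ _≤_ (∑-distribʳ-* v ℓ) (∑-distribʳ-* (λ α → v α ⊓ ℓ) h)
                      (∑-mono-≤ (λ α → m*n≤[m⊓n]*o (v≤h α) ℓ≤h))

5≤[3+a][1+b] : ∀ a b → a ≢ 1 → ¬ (a ≡ 0 × b ≡ 0) → 5 ≤ (3 + a) * (1 + b)
5≤[3+a][1+b] zero          zero    _   ¬a≡0∧b≡0 = contradiction (refl , refl) ¬a≡0∧b≡0
5≤[3+a][1+b] zero          (suc b) _   _        = ≤-trans (n≤1+n 5) (*-monoʳ-≤ 3 (m≤m+n 2 b))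
5≤[3+a][1+b] (suc zero)    b       a≢1 _        = contradiction refl a≢1
5≤[3+a][1+b] (suc (suc a)) b       _   _        = *-mono-≤ (m≤m+n 5 a) (s≤s (z≤n {b}))

-- Given 2 N ≥ (p − 2) ℓ + 1, it suffices that (p − 2) ℓ + 3 ≥ 2 (p + ℓ), i.e. (p − 4)(ℓ − 2) ≥ 5,
-- which fails only for ℓ = 3 and p ∈ {7, 8}.
p+ℓ≤N+1 : ∀ {p ℓ N} → 7 ≤ p → p ≢ 8 → 3 ≤ ℓ → ¬ (p ≡ 7 × ℓ ≡ 3) → (p ∸ 2) * ℓ < 2 * N → p + ℓ ≤ N + 1
p+ℓ≤N+1 {N = N} 7≤p p≢8 3≤ℓ ¬p≡7∧ℓ≡3 dense with m≤n⇒∃[o]m+o≡n 7≤p | m≤n⇒∃[o]m+o≡n 3≤ℓ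
... | a , refl | b , refl = *-cancelˡ-≤ 2 (+-cancelʳ-≤ 5 _ _ (begin
  2 * (7 + a + (3 + b)) + 5                    ≤⟨ +-monoʳ-≤ (2 * (7 + a + (3 + b))) 5≤ ⟩
  2 * (7 + a + (3 + b)) + (3 + a) * (1 + b)    ≡⟨ expand ⟩
  suc ((5 + a) * (3 + b)) + 7                  ≤⟨ +-monoˡ-≤ 7 dense ⟩
  2 * N + 7                                    ≡⟨ regroup ⟩
  2 * (N + 1) + 5                              ∎))
  where
  open ≤-Reasoning
  5≤ : 5 ≤ (3 + a) * (1 + b)
  5≤ = 5≤[3+a][1+b] a b (p≢8 ∘ cong (7 +_))
                     (λ (a≡0 , b≡0) → ¬p≡7∧ℓ≡3 (cong (7 +_) a≡0 , cong (3 +_) b≡0))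
  expand : 2 * (7 + a + (3 + b)) + (3 + a) * (1 + b) ≡ suc ((5 + a) * (3 + b)) + 7
  expand = solve 2 (λ a b → con 2 :* (con 7 :+ a :+ (con 3 :+ b)) :+ (con 3 :+ a) :* (con 1 :+ b)
                          := con 1 :+ (con 5 :+ a) :* (con 3 :+ b) :+ con 7) refl a b
  regroup : 2 * N + 7 ≡ 2 * (N + 1) + 5
  regroup = solve 1 (λ N → con 2 :* N :+ con 7 := con 2 :* (N :+ con 1) :+ con 5) refl N

-- The case (p, ℓ) = (7, 3): if ∑ min(v α, 3) ≤ 8, at most two α have v α ≥ 3,
-- so ∑ v ≤ 8 + 2 (h − 3), which contradicts 5 h < 2 ∑ v once h ≥ 4.
cappedSize₃≥9 : ∀ {n} (v : Fin n → ℕ) {h} → 4 ≤ h → (∀ α → v α ≤ h) → 5 * h < 2 * ∑ v →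
                9 ≤ cappedSize v 3
cappedSize₃≥9 {n} v {h} 4≤h v≤h dense with 9 ≤? cappedSize v 3 | m≤n⇒∃[o]m+o≡n 4≤h
... | yes 9≤N | _       = 9≤N
... | no  9≰N | k , refl = contradiction 2u≤5h (<⇒≱ dense)
  where
  open ≤-Reasoning
  N≤8 : cappedSize v 3 ≤ 8
  N≤8 = ≤-pred (≰⇒> 9≰N)
  Large : FinSet n
  Large = atLeast v 3
  𝟙*3≤v⊓3 : ∀ α → 𝟙 (Large α) * 3 ≤ v α ⊓ 3
  𝟙*3≤v⊓3 α with 3 ≤? v α
  ... | yes 3≤vα = ≤-reflexive (sym (m≥n⇒m⊓n≡n 3≤vα))
  ... | no  _    = z≤n
  v≤v⊓3+𝟙*[h∸3] : ∀ α → v α ≤ v α ⊓ 3 + 𝟙 (Large α) * (1 + k)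
  v≤v⊓3+𝟙*[h∸3] α with 3 ≤? v α
  ... | yes 3≤vα rewrite m≥n⇒m⊓n≡n 3≤vα =
    ≤-trans (v≤h α) (≤-reflexive (cong (3 +_) (sym (+-identityʳ (1 + k)))))
  ... | no  3≰vα = ≤-trans (≤-reflexive (sym (m≤n⇒m⊓n≡m (<⇒≤ (≰⇒> 3≰vα))))) (m≤m+n _ _)
  ∣Large∣≤2 : ∣ Large ∣ ≤ 2
  ∣Large∣≤2 = ≤-pred (*-cancelʳ-< 3 ∣ Large ∣ 3 (s≤s (begin
    ∣ Large ∣ * 3                   ≡⟨ ∑-distribʳ-* (𝟙 ∘ Large) 3 ⟨
    ∑ (λ α → 𝟙 (Large α) * 3)       ≤⟨ ∑-mono-≤ 𝟙*3≤v⊓3 ⟩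
    cappedSize v 3                  ≤⟨ N≤8 ⟩
    8                               ∎)))
  ∑v≤8+2[h∸3] : ∑ v ≤ 8 + 2 * (1 + k)
  ∑v≤8+2[h∸3] = begin
    ∑ v                                                ≤⟨ ∑-mono-≤ v≤v⊓3+𝟙*[h∸3] ⟩
    ∑ (λ α → v α ⊓ 3 + 𝟙 (Large α) * (1 + k))          ≡⟨ ∑-distrib-+ (λ α → v α ⊓ 3) _ ⟩
    cappedSize v 3 + ∑ (λ α → 𝟙 (Large α) * (1 + k))  ≡⟨ cong (cappedSize v 3 +_) (∑-distribʳ-* (𝟙 ∘ Large) (1 + k)) ⟩
    cappedSize v 3 + ∣ Large ∣ * (1 + k)               ≤⟨ +-mono-≤ N≤8 (*-monoˡ-≤ (1 + k) ∣Large∣≤2) ⟩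
    8 + 2 * (1 + k)                                    ∎
  2u≤5h : 2 * ∑ v ≤ 5 * (4 + k)
  2u≤5h = ≤-trans (*-monoʳ-≤ 2 ∑v≤8+2[h∸3])
                  (subst (2 * (8 + 2 * (1 + k)) ≤_) 2[8+2[1+k]]+k≡5[4+k] (m≤m+n _ k))
    where
    2[8+2[1+k]]+k≡5[4+k] : 2 * (8 + 2 * (1 + k)) + k ≡ 5 * (4 + k)
    2[8+2[1+k]]+k≡5[4+k] = solve 1 (λ k → con 2 :* (con 8 :+ con 2 :* (con 1 :+ k)) :+ k := con 5 :* (con 4 :+ k)) refl k

cappedSize-bound : ∀ {n} (v : Fin n → ℕ) {p h ℓ} → 7 ≤ p → p ≢ 8 → 4 ≤ h → 3 ≤ ℓ → (∀ α → v α ≤ h) →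
                   (p ∸ 2) * h < 2 * ∑ v → ℓ + p ≤ ∑ v + 1 → p + ℓ ≤ cappedSize v ℓ + 1
cappedSize-bound v {p} {h} {ℓ} 7≤p p≢8 4≤h 3≤ℓ v≤h dense ℓ+p≤u+1
  with h ≤? ℓ
... | yes h≤ℓ = subst (λ N → p + ℓ ≤ N + 1) (sym (cappedSize-≡-∑ v (λ α → ≤-trans (v≤h α) h≤ℓ)))
                          (subst (_≤ ∑ v + 1) (+-comm ℓ p) ℓ+p≤u+1)
... | no h≰ℓ with (p ≟ 7) ×-dec (ℓ ≟ 3)
...   | yes (refl , refl) = +-monoˡ-≤ 1 (cappedSize₃≥9 v 4≤h v≤h dense)
...   | no ¬p≡7∧ℓ≡3 = p+ℓ≤N+1 7≤p p≢8 3≤ℓ ¬p≡7∧ℓ≡3 ℓ-dense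
  where
  ℓ-dense : (p ∸ 2) * ℓ < 2 * cappedSize v ℓ
  ℓ-dense = cappedSize-density v {p ∸ 2} {{>-nonZero (≤-trans (s≤s z≤n) 3≤ℓ)}} v≤h (<⇒≤ (≰⇒> h≰ℓ)) dense

lemma3p10 : (p : ℕ) .{{_ : NonZero p}} → Prime p → 7 ≤ p →
    (h : ℕ) → 4 ≤ h →
    (v : Multiset p) →
    ((α : Fin p) → toℕ α ≡ 0 → v α ≡ 0) →
    ((α : Fin p) → v α ≤ h) →
    (p ∸ 2) * h < 2 * size v →
    (ℓ : ℕ) → 3 ≤ ℓ → ℓ + p ≤ size v + 1 →
    SigmaFull v ℓ
lemma3p10 (suc q) isPrime 7≤p h 4≤h v _ v≤h dense ℓ 3≤ℓ ℓ+p≤u+1 x = X⊆Σ x (∣∣≥n⇒full X P≤∣X∣ x)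
  where
  open ZMod q
  ℓ≤u : ℓ ≤ ∑ v
  ℓ≤u = +-cancelʳ-≤ 1 ℓ (∑ v) (≤-trans (+-monoʳ-≤ ℓ (s≤s z≤n)) ℓ+p≤u+1)
  open LargeSubsetOfΣ (largeSubsetOfΣ isPrime ℓ v ℓ≤u)
  P≢8 : P ≢ 8
  P≢8 refl = prime⇒¬composite isPrime (composite-∣ composite[4] (divides 2 refl))
  P+ℓ≤N+1 : P + ℓ ≤ cappedSize v ℓ + 1
  P+ℓ≤N+1 = cappedSize-bound v 7≤p P≢8 4≤h 3≤ℓ v≤h dense ℓ+p≤u+1
  P≤∣X∣ : P ≤ ∣ X ∣
  P≤∣X∣ with X-large
  ... | inj₁ P≤∣X∣       = P≤∣X∣
  ... | inj₂ N+1≤∣X∣+ℓ = +-cancelʳ-≤ ℓ P ∣ X ∣ (≤-trans P+ℓ≤N+1 N+1≤∣X∣+ℓ)
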